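{- Let $q$ be a prime power, $g,s\ge 1$, and $V=\mathrm{GF}(q^g)^s$ regarded as a $\mathrm{GF}(q)$-vector space. For $1\le k\le s$, the number of fat $k$-dimensional $\mathrm{GF}(q)$-subspaces of $V$ is \[\#\mathcal{F}_k=q^{(g-1)\binom{k}{2}}\prod_{i=0}^{k-1}\frac{q^{g(s-i)}-1}{q^{k-i}-1}.\]
   Context: A $\mathrm{GF}(q)$-subspace $U\le V$ is called fat if $\dim_{\mathrm{GF}(q^g)}\langle U\rangle_{\mathrm{GF}(q^g)}=\dim_{\mathrm{GF}(q)}U$, where $\langle U\rangle_{\mathrm{GF}(q^g)}$ is the $\mathrm{GF}(q^g)$-span of $U$. $\mathcal{F}_k$ denotes the set of fat $k$-dimensional $\mathrm{GF}(q)$-subspaces of $V$. -}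

module Defs where

open import Data.Nat as ℕ using (ℕ; zero; suc; _^_; _≤_)
open import Data.Nat.Primality using (Prime)
open import Data.Fin using (Fin; zero; suc; funToFin)
open import Data.Fin.Subset using (Subset; _∈_)
open import Data.Product using (Σ; ∃; ∃-syntax; _×_)
open import Data.Irrelevant using (Irrelevant)
open import Function using (_∘_)
open import Relation.Binary.PropositionalEquality using (_≡_; _≢_; _≗_)
open import Algebra.Structures using (IsCommutativeRing)

IsPrimePower : ℕ → Set
IsPrimePower q = ∃[ p ] ∃[ e ] (Prime p × 1 ≤ e × q ≡ p ^ e)

-- A field whose carrier is Fin n (so it has exactly n elements).
record FieldOn (n : ℕ) : Set where
  infixl 6 _+_
  infixl 7 _*_
  field
    _+_ _*_ : Fin n → Fin n → Fin n
    -_      : Fin n → Fin n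
    0# 1#   : Fin n
    isCommutativeRing : IsCommutativeRing _≡_ _+_ _*_ -_ 0# 1#
    0≢1     : 0# ≢ 1#
    inverse : ∀ x → x ≢ 0# → ∃[ y ] (x * y ≡ 1#)

prod : ℕ → (ℕ → ℕ) → ℕ
prod zero    f = 1
prod (suc k) f = prod k f ℕ.* f k

record IsEmbedding {q Q : ℕ} (F : FieldOn q) (E : FieldOn Q) (ι : Fin q → Fin Q) : Set where
  private module F = FieldOn F
  private module E = FieldOn E
  field
    ι-+   : ∀ a b → ι (a F.+ b) ≡ ι a E.+ ι b
    ι-*   : ∀ a b → ι (a F.* b) ≡ ι a E.* ι b
    ι-1   : ι F.1# ≡ E.1#
    ι-inj : ∀ a b → ι a ≡ ι b → a ≡ b

module Setting {q g : ℕ} (F : FieldOn q) (E : FieldOn (q ^ g)) (ι : Fin q → Fin (q ^ g)) (s : ℕ) where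
  private module F = FieldOn F
  private module E = FieldOn E

  Q : ℕ
  Q = q ^ g

  V : Set
  V = Fin s → Fin Q

  0V : V
  0V _ = E.0#

  _+V_ : V → V → V
  (u +V v) j = u j E.+ v j

  _•_ : Fin Q → V → V
  (c • v) j = c E.* v j

  linComb : ∀ {m} → (Fin m → Fin Q) → (Fin m → V) → V
  linComb {zero}  c u = 0V
  linComb {suc m} c u = (c zero • u zero) +V linComb (c ∘ suc) (u ∘ suc)

  -- subsets of V: V has Q ^ s elements, indexed bijectively by funToFin
  SubsetV : Set
  SubsetV = Subset (Q ^ s)

  _∈V_ : V → SubsetV → Set
  v ∈V S = funToFin v ∈ S

  IsFSubspace : (V → Set) → Set
  IsFSubspace P = P 0V × (∀ u v → P u → P v → P (u +V v)) × (∀ a v → P v → P (ι a • v))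

  FIndep : ∀ {k} → (Fin k → V) → Set
  FIndep u = ∀ c → linComb (ι ∘ c) u ≗ 0V → ∀ i → c i ≡ F.0#

  FSpans : ∀ {k} → (V → Set) → (Fin k → V) → Set
  FSpans P u = ∀ v → P v → ∃[ c ] (v ≗ linComb (ι ∘ c) u)

  HasFDim : (V → Set) → ℕ → Set
  HasFDim P k = ∃[ u ] ((∀ (i : Fin k) → P (u i)) × FIndep u × FSpans P u)

  EIndep : ∀ {k} → (Fin k → V) → Set
  EIndep u = ∀ c → linComb c u ≗ 0V → ∀ i → c i ≡ E.0#

  ESpans : ∀ {k} → (V → Set) → (Fin k → V) → Set
  ESpans P u = ∀ v → P v → ∃[ c ] (v ≗ linComb c u)

  HasEDim : (V → Set) → ℕ → Set
  HasEDim P k = ∃[ u ] ((∀ (i : Fin k) → P (u i)) × EIndep u × ESpans P u)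

  ESpan : (V → Set) → V → Set
  ESpan P v = ∃[ m ] ∃[ c ] ∃[ u ] ((∀ (i : Fin m) → P (u i)) × v ≗ linComb c u)

  IsFat : ℕ → SubsetV → Set
  IsFat k S = IsFSubspace (_∈V S) × HasFDim (_∈V S) k × HasEDim (ESpan (_∈V S)) k

  -- 𝓕_k (membership proofs made irrelevant, so elements are just subsets)
  𝓕 : ℕ → Set
  𝓕 k = Σ SubsetV (λ S → Irrelevant (IsFat k S))

module Submission where

-- Counting fat subspaces by double counting.
--
-- Let F = GF(q) ⊆ E = GF(q^g) = GF(Q) and V = E^s.  The F-span of a k-tuple of
-- E-independent vectors is a fat k-subspace, and every fat k-subspace arises this
-- way.  Sorting the ∏_{i<k} (Q^s - Q^i) E-independent k-tuples by their F-span, each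
-- fat S is hit by exactly its F-bases, i.e. the F-independent k-tuples in S, of which
-- there are ∏_{i<k} (q^k - q^i); both counts are instances of one lemma counting
-- independent tuples inside a span-closed set.  Hence
--   #𝓕_k · ∏ (q^k - q^i) = ∏ (Q^s - Q^i),
-- and cancelling q^(k choose 2) from both sides gives the theorem.

open import Defs
open import Data.Nat using (ℕ; _^_; _*_; _∸_; _≤_)
open import Data.Nat.Combinatorics using (_C_)
open import Data.Fin using (Fin)
open import Data.Product using (_×_; ∃-syntax)
open import Function.Bundles using (_↔_)
open import Relation.Binary.PropositionalEquality using (_≡_)

open import Data.Nat using (zero; suc; _+_; NonZero)
open import Data.Nat.Combinatorics using (nCk+nC[k+1]≡[n+1]C[k+1]; nC1≡n)
open import Data.Nat.Primality using (prime⇒nonZero)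
import Data.Nat.Properties as ℕP
import Algebra.Properties.CommutativeSemigroup ℕP.*-commutativeSemigroup as *-Comm
open import Data.Fin as Fin using (zero; suc; funToFin; finToFun)
import Data.Fin.Properties as FinP
open import Data.Bool using (Bool; true; false; T; _∧_; not; if_then_else_)
import Data.Bool.Properties as BoolP
open import Data.Product using (Σ; _,_; proj₁; proj₂; ∃)
open import Data.Product.Function.Dependent.Propositional using (Σ-↔)
open import Data.Sum using (_⊎_; inj₁; inj₂)
open import Data.Sum.Function.Propositional using (_⊎-↔_)
open import Data.Product.Function.NonDependent.Propositional using (_×-↔_)
open import Data.Unit using (tt)
open import Data.Irrelevant using ([_])
open import Data.Vec using (Vec; []; _∷_; lookup; tabulate)
import Data.Vec.Properties as VecP
open import Data.Fin.Subset using (_∈_; _⊆_)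
open import Data.Fin.Subset.Properties using (⊆-antisym)
open import Data.Vec.Functional using () renaming (_∷_ to _∷ᶠ_)
open import Function using (_∘_)
open import Function.Definitions using (Injective)
open import Function.Bundles using (Inverse; Equivalence; Injection; mk↔ₛ′)
open import Function.Properties.Inverse using (↔-trans; ↔-sym; ↔-refl; ↔⇒↣)
open import Relation.Nullary using (¬_; Dec; yes; no; contradiction)
open import Relation.Nullary.Decidable using (isYes; map′; recompute; T?; toWitness; fromWitness; toWitnessFalse; fromWitnessFalse)
open import Level using (0ℓ)
open import Algebra.Bundles using (CommutativeRing)
import Algebra.Properties.Ring as RingProperties
import Algebra.Solver.Ring.NaturalCoefficients.Default as Solver
open import Relation.Binary.PropositionalEquality using (_≢_; _≗_; refl; sym; trans; cong; cong₂; subst; module ≡-Reasoning)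

private variable
  A B : Set

↔-size : ∀ {m n} → Fin m ↔ A → Fin n ↔ A → m ≡ n
↔-size e f = FinP.cantor-schröder-bernstein (injective (↔-trans e (↔-sym f))) (injective (↔-trans f (↔-sym e)))
  where
  injective : ∀ {a b} (h : Fin a ↔ Fin b) → Injective _≡_ _≡_ (Inverse.to h)
  injective h = Injection.injective (↔⇒↣ h)

-- Pigeonhole: an injective self-map of Fin n is onto.  A missed value y would let
-- punchOut squeeze Fin n injectively into Fin (n - 1).
injective⇒surjective : ∀ {n} (f : Fin n → Fin n) → Injective _≡_ _≡_ f → ∀ y → ∃ λ x → f x ≡ y
injective⇒surjective f inj y with FinP.any? (λ x → f x FinP.≟ y)
... | yes hit = hit
injective⇒surjective {suc m} f inj y | no miss = contradiction (FinP.injective⇒≤ squeeze-inj) ℕP.1+n≰n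
  where
  y≢f : ∀ x → y ≢ f x
  y≢f x y≡fx = miss (x , sym y≡fx)
  squeeze : Fin (suc m) → Fin m
  squeeze x = Fin.punchOut (y≢f x)
  squeeze-inj : Injective _≡_ _≡_ squeeze
  squeeze-inj eq = inj (FinP.punchOut-injective (y≢f _) (y≢f _) eq)

funToFin-cong : ∀ {m n} {f h : Fin m → Fin n} → (∀ i → f i ≡ h i) → funToFin f ≡ funToFin h
funToFin-cong {zero}  e = refl
funToFin-cong {suc m} e = cong₂ Fin.combine (e zero) (funToFin-cong (e ∘ suc))

finToFun-injective : ∀ {m n} {a b : Fin (n ^ m)} → (∀ i → finToFun {n} {m} a i ≡ finToFun b i) → a ≡ b
finToFun-injective {m} {n} {a} {b} e =
  trans (sym (FinP.funToFin-finToFin {m} {n} a)) (trans (funToFin-cong e) (FinP.funToFin-finToFin {m} {n} b))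

-- The elements of A satisfying a Boolean predicate; such an element is determined
-- by its first component since T b has at most one proof.
ΣT : (A → Bool) → Set
ΣT {A} p = Σ A (T ∘ p)

ΣT-≡ : {p : A → Bool} {x y : ΣT p} → proj₁ x ≡ proj₁ y → x ≡ y
ΣT-≡ {x = x , u} {y = .x , v} refl = cong (x ,_) (BoolP.T-irrelevant u v)

ΣT-cong : {p p′ : A → Bool} → (∀ x → p x ≡ p′ x) → ΣT p ↔ ΣT p′
ΣT-cong {p = p} e = Σ-↔ ↔-refl (λ {x} → subst (λ b → T (p x) ↔ T b) (e x) ↔-refl)

ΣT-transport : (e : A ↔ B) (p : B → Bool) → ΣT (p ∘ Inverse.to e) ↔ ΣT p
ΣT-transport e p = Σ-↔ e ↔-refl

∧-implied : ∀ {a b} → (T a → T b) → a ∧ b ≡ a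
∧-implied {false}          _   = refl
∧-implied {true}  {true}   _   = refl
∧-implied {true}  {false}  a⇒b = contradiction (a⇒b tt) (λ ())

T-∧-split : ∀ {a b} → T (a ∧ b) → T a × T b
T-∧-split {a} {b} = Equivalence.to (BoolP.T-∧ {a} {b})

T-∧-join : ∀ {a b} → T a → T b → T (a ∧ b)
T-∧-join {a} {b} x y = Equivalence.from (BoolP.T-∧ {a} {b}) (x , y)

Σ-uniform : ∀ {a b} {P : A → Set} → Fin a ↔ A → (∀ x → Fin b ↔ P x) → Fin (a * b) ↔ Σ A P
Σ-uniform ea eb = ↔-trans FinP.*↔× (Σ-↔ ea (eb _))

count : ∀ {n} → (Fin n → Bool) → ℕ
count {zero}  p = 0
count {suc n} p = (if p zero then 1 else 0) + count (p ∘ suc)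

countEnum : ∀ {n} (p : Fin n → Bool) → Fin (count p) ↔ ΣT p
countEnum {zero}  p = mk↔ₛ′ (λ ()) (λ { (() , _) }) (λ { (() , _) }) (λ ())
countEnum {suc n} p = ↔-trans (↔-trans FinP.+↔⊎ (head (p zero) ⊎-↔ countEnum (p ∘ suc))) split
  where
  head : (b : Bool) → Fin (if b then 1 else 0) ↔ T b
  head true  = FinP.1↔⊤
  head false = FinP.0↔⊥
  split : (T (p zero) ⊎ ΣT (p ∘ suc)) ↔ ΣT p
  split = mk↔ₛ′ (λ { (inj₁ t) → zero , t ; (inj₂ (i , t)) → suc i , t })
                (λ { (zero , t) → inj₁ t ; (suc i , t) → inj₂ (i , t) })
                (λ { (zero , t) → refl ; (suc i , t) → refl })
                (λ { (inj₁ t) → refl ; (inj₂ _) → refl })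

count-size : ∀ {n m} (p : Fin n → Bool) → Fin m ↔ ΣT p → m ≡ count p
count-size p e = ↔-size e (countEnum p)

count-cong : ∀ {n} {p p′ : Fin n → Bool} → (∀ i → p i ≡ p′ i) → count p ≡ count p′
count-cong {zero}  e = refl
count-cong {suc n} e = cong₂ (λ b c → (if b then 1 else 0) + c) (e zero) (count-cong (e ∘ suc))

count-split : ∀ {n} (q p : Fin n → Bool) → count p ≡ count (λ i → q i ∧ p i) + count (λ i → not (q i) ∧ p i)
count-split {zero}  q p = refl
count-split {suc n} q p with q zero | p zero | count-split (q ∘ suc) (p ∘ suc)
... | true  | true  | ih = cong suc ih
... | true  | false | ih = ih
... | false | true  | ih = trans (cong suc ih) (sym (ℕP.+-suc _ _))
... | false | false | ih = ih

vecEnum : ∀ {m} n → Fin m ↔ A → Fin (m ^ n) ↔ Vec A n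
vecEnum zero    e = mk↔ₛ′ (λ _ → []) (λ _ → zero) (λ { [] → refl }) (λ { zero → refl })
vecEnum (suc n) e = ↔-trans FinP.*↔× (↔-trans (e ×-↔ vecEnum n e) cons↔)
  where
  cons↔ : (A × Vec A n) ↔ Vec A (suc n)
  cons↔ = mk↔ₛ′ (λ (x , v) → x ∷ v) (λ { (x ∷ v) → x , v }) (λ { (x ∷ v) → refl }) (λ (x , v) → refl)

any?-enum : ∀ {n} {P : A → Set} → Fin n ↔ A → (∀ a → Dec (P a)) → Dec (∃ P)
any?-enum {P = P} e P? = map′ (λ (i , p) → Inverse.to e i , p)
                              (λ (a , p) → Inverse.from e a , subst P (sym (Inverse.strictlyInverseˡ e a)) p)
                              (FinP.any? (P? ∘ Inverse.to e))

T-ext : ∀ {a b} → (T a → T b) → (T b → T a) → a ≡ b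
T-ext {false} {false} _   _   = refl
T-ext {false} {true}  _   b⇒a = contradiction (b⇒a tt) (λ ())
T-ext {true}  {false} a⇒b _   = contradiction (a⇒b tt) (λ ())
T-ext {true}  {true}  _   _   = refl

∈-tabulate⁺ : ∀ {n} (f : Fin n → Bool) {x} → T (f x) → x ∈ tabulate f
∈-tabulate⁺ f {x} fx = VecP.lookup⇒[]= x (tabulate f) (trans (VecP.lookup∘tabulate f x) (Equivalence.to BoolP.T-≡ fx))

∈-tabulate⁻ : ∀ {n} (f : Fin n → Bool) {x} → x ∈ tabulate f → T (f x)
∈-tabulate⁻ f {x} x∈ = Equivalence.from BoolP.T-≡ (trans (sym (VecP.lookup∘tabulate f x)) (VecP.[]=⇒lookup x∈))

module FieldFacts {n} (K : FieldOn n) where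
  open FieldOn K public renaming (_+_ to _⊕_; _*_ to _⊗_; -_ to ⊖_)

  commutativeRing : CommutativeRing 0ℓ 0ℓ
  commutativeRing = record { Carrier = Fin n ; _≈_ = _≡_ ; _+_ = _⊕_ ; _*_ = _⊗_ ; -_ = ⊖_ ; 0# = 0# ; 1# = 1#
                           ; isCommutativeRing = isCommutativeRing }

  open CommutativeRing commutativeRing public
    using (+-identityˡ; +-identityʳ; *-identityˡ; zeroˡ; zeroʳ; -‿inverseˡ; -‿inverseʳ)
  open RingProperties (CommutativeRing.ring commutativeRing) public
    using (-‿distribˡ-*; -‿distribʳ-*; -‿involutive; -0#≈0#; -‿+-comm; +-inverseˡ-unique; x+x≈x⇒x≈0; -1*x≈-x)
  open Solver (CommutativeRing.commutativeSemiring commutativeRing)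

  +-interchange-* : ∀ a b x y z → (a ⊕ b) ⊗ x ⊕ (y ⊕ z) ≡ (a ⊗ x ⊕ y) ⊕ (b ⊗ x ⊕ z)
  +-interchange-* = solve 5 (λ a b x y z → (a :+ b) :* x :+ (y :+ z) := (a :* x :+ y) :+ (b :* x :+ z)) refl

  *-factor : ∀ a b x y → (a ⊗ b) ⊗ x ⊕ a ⊗ y ≡ a ⊗ (b ⊗ x ⊕ y)
  *-factor = solve 4 (λ a b x y → (a :* b) :* x :+ a :* y := a :* (b :* x :+ y)) refl

  *-swap : ∀ a b x → (a ⊗ b) ⊗ x ≡ b ⊗ (a ⊗ x)
  *-swap = solve 3 (λ a b x → (a :* b) :* x := b :* (a :* x)) refl

  neg-factor : ∀ a x y → (⊖ a) ⊗ x ⊕ ⊖ y ≡ ⊖ (a ⊗ x ⊕ y)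
  neg-factor a x y = trans (cong (_⊕ ⊖ y) (sym (-‿distribˡ-* a x))) (-‿+-comm _ _)

  -1≢0 : ⊖ 1# ≢ 0#
  -1≢0 e = 0≢1 (sym (trans (sym (-‿involutive 1#)) (trans (cong ⊖_ e) -0#≈0#)))

-- Linear algebra in V = E^s.  Linear combinations are always formed with
-- coefficients in E; a subfield K ↪ E restricts the coefficients (K = F gives the
-- GF(q)-notions of the statement, K = E the GF(q^g)-notions).
module LinearAlgebra {q g : ℕ} (F : FieldOn q) (E : FieldOn (q ^ g)) (ι : Fin q → Fin (q ^ g)) (s : ℕ) where
  open Setting {q} {g} F E ι s
  module E = FieldFacts E

  M : ℕ
  M = Q ^ s

  vec : Fin M → V
  vec = finToFun

  vec-code : ∀ v → vec (funToFin v) ≗ v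
  vec-code = FinP.finToFun-funToFin

  code-vec : ∀ x → funToFin (vec x) ≡ x
  code-vec = FinP.funToFin-finToFin {s} {Q}

  -- k-tuples of vectors, coded as vectors of codes so that they have decidable
  -- equality and cons/uncons are inverse on the nose.
  Tuple : ℕ → Set
  Tuple k = Vec (Fin M) k

  vecs : ∀ {k} → Tuple k → Fin k → V
  vecs t i = vec (lookup t i)

  _≗?_ : (x y : V) → Dec (x ≗ y)
  x ≗? y = FinP.all? (λ j → x j FinP.≟ y j)

  linComb-cong : ∀ {m} {c d : Fin m → Fin Q} {u w : Fin m → V} →
                 (∀ i → c i ≡ d i) → (∀ i → u i ≗ w i) → linComb c u ≗ linComb d w
  linComb-cong {zero}  ec eu j = refl
  linComb-cong {suc m} ec eu j = cong₂ E._⊕_ (cong₂ E._⊗_ (ec zero) (eu zero j)) (linComb-cong (ec ∘ suc) (eu ∘ suc) j)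

  linComb-congˡ : ∀ {m} {c d : Fin m → Fin Q} (u : Fin m → V) → (∀ i → c i ≡ d i) → linComb c u ≗ linComb d u
  linComb-congˡ u ec = linComb-cong ec (λ _ _ → refl)

  linComb-congʳ : ∀ {m} (c : Fin m → Fin Q) {u w : Fin m → V} → (∀ i → u i ≗ w i) → linComb c u ≗ linComb c w
  linComb-congʳ c = linComb-cong (λ _ → refl)

  linComb-zero : ∀ {m} (u : Fin m → V) → linComb (λ _ → E.0#) u ≗ 0V
  linComb-zero {zero}  u j = refl
  linComb-zero {suc m} u j = trans (cong₂ E._⊕_ (E.zeroˡ _) (linComb-zero (u ∘ suc) j)) (E.+-identityˡ E.0#)

  linComb-+ : ∀ {m} (c d : Fin m → Fin Q) (u : Fin m → V) → linComb (λ i → c i E.⊕ d i) u ≗ (linComb c u +V linComb d u)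
  linComb-+ {zero}  c d u j = sym (E.+-identityˡ E.0#)
  linComb-+ {suc m} c d u j =
    trans (cong ((c zero E.⊕ d zero) E.⊗ u zero j E.⊕_) (linComb-+ (c ∘ suc) (d ∘ suc) (u ∘ suc) j)) (E.+-interchange-* _ _ _ _ _)

  linComb-* : ∀ {m} a (c : Fin m → Fin Q) (u : Fin m → V) → linComb (λ i → a E.⊗ c i) u ≗ (a • linComb c u)
  linComb-* {zero}  a c u j = sym (E.zeroʳ a)
  linComb-* {suc m} a c u j = trans (cong ((a E.⊗ c zero) E.⊗ u zero j E.⊕_) (linComb-* a (c ∘ suc) (u ∘ suc) j)) (E.*-factor _ _ _ _)

  linComb-neg : ∀ {m} (c : Fin m → Fin Q) (u : Fin m → V) j → linComb (λ i → E.⊖ c i) u j ≡ E.⊖ linComb c u j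
  linComb-neg {zero}  c u j = sym E.-0#≈0#
  linComb-neg {suc m} c u j = trans (cong ((E.⊖ c zero) E.⊗ u zero j E.⊕_) (linComb-neg (c ∘ suc) (u ∘ suc) j)) (E.neg-factor _ _ _)

  module OverSubfield {r : ℕ} (K : FieldOn r) (σ : Fin r → Fin Q) (σ-emb : IsEmbedding K E σ) where
    module K = FieldFacts K
    open IsEmbedding σ-emb renaming (ι-+ to σ-+; ι-* to σ-*; ι-1 to σ-1)

    σ-0 : σ K.0# ≡ E.0#
    σ-0 = E.x+x≈x⇒x≈0 _ (trans (sym (σ-+ K.0# K.0#)) (cong σ (K.+-identityˡ K.0#)))

    σ-⊖ : ∀ a → σ (K.⊖ a) ≡ E.⊖ σ a
    σ-⊖ a = E.+-inverseˡ-unique _ _ (trans (sym (σ-+ _ _)) (trans (cong σ (K.-‿inverseˡ a)) σ-0))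

    comb : ∀ {k} → (Fin k → Fin r) → (Fin k → V) → V
    comb c u = linComb (σ ∘ c) u

    InSpan : ∀ {k} → (Fin k → V) → V → Set
    InSpan u x = ∃ λ c → x ≗ comb c u

    Indep : ∀ {k} → (Fin k → V) → Set
    Indep u = ∀ c → comb c u ≗ 0V → ∀ i → c i ≡ K.0#

    comb-congˡ : ∀ {k} {c d : Fin k → Fin r} (u : Fin k → V) → (∀ i → c i ≡ d i) → comb c u ≗ comb d u
    comb-congˡ u e = linComb-congˡ u (cong σ ∘ e)

    comb-zero : ∀ {k} (u : Fin k → V) → comb (λ _ → K.0#) u ≗ 0V
    comb-zero u j = trans (linComb-congˡ u (λ _ → σ-0) j) (linComb-zero u j)

    comb-+ : ∀ {k} (c d : Fin k → Fin r) (u : Fin k → V) → comb (λ i → c i K.⊕ d i) u ≗ (comb c u +V comb d u)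
    comb-+ c d u j = trans (linComb-congˡ u (λ i → σ-+ (c i) (d i)) j) (linComb-+ (σ ∘ c) (σ ∘ d) u j)

    comb-* : ∀ {k} a (c : Fin k → Fin r) (u : Fin k → V) → comb (λ i → a K.⊗ c i) u ≗ (σ a • comb c u)
    comb-* a c u j = trans (linComb-congˡ u (λ i → σ-* a (c i)) j) (linComb-* (σ a) (σ ∘ c) u j)

    comb-⊖ : ∀ {k} (c : Fin k → Fin r) (u : Fin k → V) j → comb (λ i → K.⊖ c i) u j ≡ E.⊖ comb c u j
    comb-⊖ c u j = trans (linComb-congˡ u (σ-⊖ ∘ c) j) (linComb-neg (σ ∘ c) u j)

    Indep⇒unique : ∀ {k} {u : Fin k → V} → Indep u → ∀ c d → comb c u ≗ comb d u → ∀ i → c i ≡ d i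
    Indep⇒unique {u = u} indep c d c≗d i =
      trans (K.+-inverseˡ-unique _ _ (indep (λ i → c i K.⊕ K.⊖ d i) difference≗0 i)) (K.-‿involutive (d i))
      where
      difference≗0 : comb (λ i → c i K.⊕ K.⊖ d i) u ≗ 0V
      difference≗0 j = begin
        comb (λ i → c i K.⊕ K.⊖ d i) u j ≡⟨ comb-+ c (λ i → K.⊖ d i) u j ⟩
        comb c u j E.⊕ comb (λ i → K.⊖ d i) u j ≡⟨ cong (comb c u j E.⊕_) (comb-⊖ d u j) ⟩
        comb c u j E.⊕ E.⊖ comb d u j ≡⟨ cong (λ z → z E.⊕ E.⊖ comb d u j) (c≗d j) ⟩
        comb d u j E.⊕ E.⊖ comb d u j ≡⟨ E.-‿inverseʳ _ ⟩
        E.0# ∎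
        where open ≡-Reasoning

    unique⇒Indep : ∀ {k} {u : Fin k → V} → (∀ c d → comb c u ≗ comb d u → ∀ i → c i ≡ d i) → Indep u
    unique⇒Indep {u = u} unique c c≗0 = unique c (λ _ → K.0#) (λ j → trans (c≗0 j) (sym (comb-zero u j)))

    Indep-tail : ∀ {k} {u : Fin (suc k) → V} → Indep u → Indep (u ∘ suc)
    Indep-tail {u = u} indep c c≗0 i = indep (K.0# ∷ᶠ c) pad≗0 (suc i)
      where
      pad≗0 : comb (K.0# ∷ᶠ c) u ≗ 0V
      pad≗0 j = trans (cong₂ E._⊕_ (trans (cong (E._⊗ u zero j) σ-0) (E.zeroˡ _)) (c≗0 j)) (E.+-identityˡ _)

    Indep-head : ∀ {k} {u : Fin (suc k) → V} → Indep u → ¬ InSpan (u ∘ suc) (u zero)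
    Indep-head {u = u} indep (c , u₀≗) = K.-1≢0 (indep (K.⊖ K.1# ∷ᶠ c) relation zero)
      where
      relation : comb (K.⊖ K.1# ∷ᶠ c) u ≗ 0V
      relation j = trans (cong₂ E._⊕_ (trans (cong (E._⊗ u zero j) (trans (σ-⊖ _) (cong E.⊖_ σ-1))) (E.-1*x≈-x _))
                                      (sym (u₀≗ j)))
                         (E.-‿inverseˡ _)

    -- A relation with a nonzero leading coefficient c₀ expresses u₀ through the
    -- tail: u₀ = Σ (-c₀⁻¹ cᵢ) uᵢ.
    solve-for-head : ∀ {k} {u : Fin (suc k) → V} (c : Fin (suc k) → Fin r) →
                     c zero ≢ K.0# → comb c u ≗ 0V → InSpan (u ∘ suc) (u zero)
    solve-for-head {u = u} c c₀≢0 c≗0 = (λ i → K.⊖ (b K.⊗ c (suc i))) , λ j → sym (begin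
        comb (λ i → K.⊖ (b K.⊗ c (suc i))) (u ∘ suc) j ≡⟨ comb-⊖ (λ i → b K.⊗ c (suc i)) (u ∘ suc) j ⟩
        E.⊖ comb (λ i → b K.⊗ c (suc i)) (u ∘ suc) j   ≡⟨ cong E.⊖_ (comb-* b (c ∘ suc) (u ∘ suc) j) ⟩
        E.⊖ (σ b E.⊗ tail j)                          ≡⟨ E.-‿distribʳ-* (σ b) (tail j) ⟩
        σ b E.⊗ E.⊖ tail j                            ≡⟨ cong (σ b E.⊗_) (sym (E.+-inverseˡ-unique _ _ (c≗0 j))) ⟩
        σ b E.⊗ (σ (c zero) E.⊗ u zero j)             ≡⟨ sym (E.*-swap _ _ _) ⟩
        (σ (c zero) E.⊗ σ b) E.⊗ u zero j             ≡⟨ cong (E._⊗ u zero j) (trans (sym (σ-* _ _)) (cong σ c₀b≡1)) ⟩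
        σ K.1# E.⊗ u zero j                           ≡⟨ cong (E._⊗ u zero j) σ-1 ⟩
        E.1# E.⊗ u zero j                             ≡⟨ E.*-identityˡ _ ⟩
        u zero j ∎)
      where
      open ≡-Reasoning
      b : Fin r
      b = proj₁ (K.inverse (c zero) c₀≢0)
      c₀b≡1 : c zero K.⊗ b ≡ K.1#
      c₀b≡1 = proj₂ (K.inverse (c zero) c₀≢0)
      tail : V
      tail = comb (c ∘ suc) (u ∘ suc)

    Indep-∷ : ∀ {k} {u : Fin (suc k) → V} → Indep (u ∘ suc) → ¬ InSpan (u ∘ suc) (u zero) → Indep u
    Indep-∷ {u = u} indep-tail fresh c c≗0 with c zero FinP.≟ K.0#
    ... | no c₀≢0 = contradiction (solve-for-head {u = u} c c₀≢0 c≗0) fresh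
    ... | yes c₀≡0 = λ { zero → c₀≡0 ; (suc i) → indep-tail (c ∘ suc) tail≗0 i }
      where
      tail≗0 : comb (c ∘ suc) (u ∘ suc) ≗ 0V
      tail≗0 j = begin
        comb (c ∘ suc) (u ∘ suc) j                          ≡⟨ sym (E.+-identityˡ _) ⟩
        E.0# E.⊕ comb (c ∘ suc) (u ∘ suc) j                 ≡⟨ cong (E._⊕ comb (c ∘ suc) (u ∘ suc) j) (sym (E.zeroˡ (u zero j))) ⟩
        (E.0# E.⊗ u zero j) E.⊕ comb (c ∘ suc) (u ∘ suc) j  ≡⟨ cong (λ a → (a E.⊗ u zero j) E.⊕ comb (c ∘ suc) (u ∘ suc) j)
                                                                    (sym (trans (cong σ c₀≡0) σ-0)) ⟩
        comb c u j                                          ≡⟨ c≗0 j ⟩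
        E.0# ∎
        where open ≡-Reasoning

    InSpan-cong : ∀ {k} {u w : Fin k → V} {x y : V} → (∀ i → u i ≗ w i) → x ≗ y → InSpan u x → InSpan w y
    InSpan-cong u≗w x≗y (c , x≗) = c , λ j → trans (sym (x≗y j)) (trans (x≗ j) (linComb-congʳ (σ ∘ c) u≗w j))

    span-0 : ∀ {k} (u : Fin k → V) → InSpan u 0V
    span-0 u = (λ _ → K.0#) , λ j → sym (comb-zero u j)

    span-+ : ∀ {k} {u : Fin k → V} {x y : V} → InSpan u x → InSpan u y → InSpan u (x +V y)
    span-+ {u = u} (c , x≗) (d , y≗) = (λ i → c i K.⊕ d i) , λ j → trans (cong₂ E._⊕_ (x≗ j) (y≗ j)) (sym (comb-+ c d u j))

    span-• : ∀ {k} {u : Fin k → V} {x : V} a → InSpan u x → InSpan u (σ a • x)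
    span-• {u = u} a (c , x≗) = (λ i → a K.⊗ c i) , λ j → trans (cong (σ a E.⊗_) (x≗ j)) (sym (comb-* a c u j))

    unit : ∀ {k} → Fin k → Fin k → Fin r
    unit zero    = K.1# ∷ᶠ (λ _ → K.0#)
    unit (suc i) = K.0# ∷ᶠ unit i

    comb-unit : ∀ {k} (u : Fin k → V) i → comb (unit i) u ≗ u i
    comb-unit u zero    j = trans (cong₂ E._⊕_ (trans (cong (E._⊗ u zero j) σ-1) (E.*-identityˡ _)) (comb-zero (u ∘ suc) j))
                                  (E.+-identityʳ _)
    comb-unit u (suc i) j = trans (cong₂ E._⊕_ (trans (cong (E._⊗ u zero j) σ-0) (E.zeroˡ _)) (comb-unit (u ∘ suc) i j))
                                  (E.+-identityˡ _)

    span-member : ∀ {k} (u : Fin k → V) i → InSpan u (u i)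
    span-member u i = unit i , λ j → sym (comb-unit u i j)

    span-closed : ∀ {m k} (c : Fin m → Fin r) (x : Fin m → V) {u : Fin k → V} →
                  (∀ i → InSpan u (x i)) → InSpan u (comb c x)
    span-closed {zero}  c x {u} x⊆ = span-0 u
    span-closed {suc m} c x     x⊆ = span-+ (span-• (c zero) (x⊆ zero)) (span-closed (c ∘ suc) (x ∘ suc) (x⊆ ∘ suc))

    span-trans : ∀ {m k} {x : Fin m → V} {u : Fin k → V} {v : V} → (∀ i → InSpan u (x i)) → InSpan x v → InSpan u v
    span-trans {x = x} x⊆ (c , v≗) = InSpan-cong (λ _ _ → refl) (λ j → sym (v≗ j)) (span-closed c x x⊆)

    -- Span membership is decidable (try all r ^ k coefficient vectors), so a span is
    -- a Boolean predicate on vector codes.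
    span? : ∀ {k} (u : Fin k → V) (x : V) → Dec (InSpan u x)
    span? {k} u x with FinP.any? (λ a → x ≗? comb (finToFun a) u)
    ... | yes (a , x≗) = yes (finToFun a , x≗)
    ... | no none      = no λ (c , x≗) →
      none (funToFin c , λ j → trans (x≗ j) (comb-congˡ u (λ i → sym (FinP.finToFun-funToFin c i)) j))

    spanᵇ : ∀ {k} → (Fin k → V) → Fin M → Bool
    spanᵇ u x = isYes (span? u (vec x))

    -- An independent k-tuple spans exactly r ^ k vectors: a ↦ Σ aᵢ uᵢ is a bijection
    -- from coefficient codes onto the span.
    span-size : ∀ {k} (u : Fin k → V) → Indep u → Fin (r ^ k) ↔ ΣT (spanᵇ u)
    span-size {k} u indep = mk↔ₛ′ to from to∘from from∘to
      where
      combOf : Fin (r ^ k) → V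
      combOf a = comb (finToFun a) u
      to : Fin (r ^ k) → ΣT (spanᵇ u)
      to a = funToFin (combOf a) , fromWitness (finToFun a , FinP.finToFun-funToFin (combOf a))
      from : ΣT (spanᵇ u) → Fin (r ^ k)
      from (x , x∈) = funToFin (proj₁ (toWitness x∈))
      to∘from : ∀ y → to (from y) ≡ y
      to∘from (x , x∈) with toWitness x∈
      ... | c , x≗ = ΣT-≡ (finToFun-injective λ j →
        trans (FinP.finToFun-funToFin (combOf (funToFin c)) j)
              (trans (comb-congˡ u (FinP.finToFun-funToFin c) j) (sym (x≗ j))))
      from∘to : ∀ a → from (to a) ≡ a
      from∘to a with toWitness (proj₂ (to a))
      ... | c , x≗ = finToFun-injective λ i →
        trans (FinP.finToFun-funToFin c i)
              (sym (Indep⇒unique indep (finToFun a) c (λ j → trans (sym (FinP.finToFun-funToFin (combOf a) j)) (x≗ j)) i))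

    -- Choosing for every
    -- coefficient vector a of w a coefficient vector of u with the same combination
    -- gives an injective self-map `choose` of Fin (r ^ k), which is then onto.
    exchange : ∀ {k} {w u : Fin k → V} → Indep w → (∀ i → InSpan u (w i)) →
               (∀ i → InSpan w (u i)) × Indep u
    exchange {k} {w} {u} indep-w w⊆u = u⊆w , unique⇒Indep u-unique
      where
      combʷ combᵘ : Fin (r ^ k) → V
      combʷ a = comb (finToFun a) w
      combᵘ a = comb (finToFun a) u
      choose : Fin (r ^ k) → Fin (r ^ k)
      choose a = funToFin (proj₁ (span-closed (finToFun a) w w⊆u))
      choose-spec : ∀ a → combʷ a ≗ combᵘ (choose a)
      choose-spec a j with span-closed (finToFun a) w w⊆u
      ... | c , x≗ = trans (x≗ j) (comb-congˡ u (λ i → sym (FinP.finToFun-funToFin c i)) j)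
      combʷ-injective : ∀ {a b} → combʷ a ≗ combʷ b → a ≡ b
      combʷ-injective {a} {b} e = finToFun-injective (Indep⇒unique indep-w (finToFun a) (finToFun b) e)
      choose-injective : Injective _≡_ _≡_ choose
      choose-injective {a} {b} e =
        combʷ-injective λ j → trans (choose-spec a j) (trans (cong (λ z → combᵘ z j) e) (sym (choose-spec b j)))
      -- choose is onto, so every combination of u is a combination of w
      hit : ∀ d → ∃ λ a → choose a ≡ funToFin d
      hit d = injective⇒surjective choose choose-injective (funToFin d)
      hit-spec : ∀ d a → choose a ≡ funToFin d → comb d u ≗ combʷ a
      hit-spec d a a↦d j = trans (comb-congˡ u (λ i → sym (FinP.finToFun-funToFin d i)) j)
                                 (trans (cong (λ z → combᵘ z j) (sym a↦d)) (sym (choose-spec a j)))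
      u⊆w : ∀ i → InSpan w (u i)
      u⊆w i with hit (unit i)
      ... | a , a↦ = finToFun a , λ j → trans (sym (comb-unit u i j)) (hit-spec (unit i) a a↦ j)
      u-unique : ∀ d d′ → comb d u ≗ comb d′ u → ∀ i → d i ≡ d′ i
      u-unique d d′ e i with hit d | hit d′
      ... | a , a↦d | a′ , a′↦d′ = trans (sym (FinP.finToFun-funToFin d i))
                                         (trans (cong (λ z → finToFun z i) d≡d′) (FinP.finToFun-funToFin d′ i))
        where
        a≡a′ : a ≡ a′
        a≡a′ = combʷ-injective λ j → trans (sym (hit-spec d a a↦d j)) (trans (e j) (hit-spec d′ a′ a′↦d′ j))
        d≡d′ : funToFin d ≡ funToFin d′
        d≡d′ = trans (sym a↦d) (trans (cong choose a≡a′) a′↦d′)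

    -- Counting independent tuples inside a set W of w vectors that contains the
    -- span of every tuple of its elements: an independent i-tuple extends by exactly
    -- the w - r ^ i elements of W outside its span, so there are ∏_{i<k} (w - r ^ i)
    -- independent k-tuples with entries in W.
    module IndependentTuples (W : Fin M → Bool) {w : ℕ} (W-size : Fin w ↔ ΣT W)
      (W-closed : ∀ {k} (t : Tuple k) → (∀ i → T (W (lookup t i))) → ∀ x → T (spanᵇ (vecs t) x) → T (W x)) where

      fresh : ∀ {k} → Tuple k → Fin M → Bool
      fresh t x = not (spanᵇ (vecs t) x) ∧ W x

      good : ∀ {k} → Tuple k → Bool
      good []      = true
      good (x ∷ t) = fresh t x ∧ good t

      good⇒ : ∀ {k} (t : Tuple k) → T (good t) → Indep (vecs t) × (∀ i → T (W (lookup t i)))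
      good⇒ []      _  = (λ _ _ ()) , (λ ())
      good⇒ (x ∷ t) gt with T-∧-split {fresh t x} gt
      ... | fx , gt′ with T-∧-split {not (spanᵇ (vecs t) x)} fx | good⇒ t gt′
      ... | x∉ , x∈W | indep , t∈W =
        Indep-∷ {u = vecs (x ∷ t)} indep (toWitnessFalse x∉) , λ { zero → x∈W ; (suc i) → t∈W i }

      ⇒good : ∀ {k} (t : Tuple k) → Indep (vecs t) → (∀ i → T (W (lookup t i))) → T (good t)
      ⇒good []      _     _   = tt
      ⇒good (x ∷ t) indep t∈W =
        T-∧-join (T-∧-join (fromWitnessFalse (Indep-head {u = vecs (x ∷ t)} indep)) (t∈W zero))
                 (⇒good t (Indep-tail {u = vecs (x ∷ t)} indep) (t∈W ∘ suc))

      -- W splits into the span of t, which it contains, and the fresh vectors.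
      fresh-size : ∀ {k} (t : Tuple k) → T (good t) → Fin (w ∸ r ^ k) ↔ ΣT (fresh t)
      fresh-size {k} t gt = subst (λ n → Fin n ↔ ΣT (fresh t)) count-fresh (countEnum (fresh t))
        where
        span-t = spanᵇ (vecs t)
        span⊆W : ∀ x → span-t x ∧ W x ≡ span-t x
        span⊆W x = ∧-implied (W-closed t (proj₂ (good⇒ t gt)) x)
        partition : w ≡ r ^ k + count (fresh t)
        partition = begin
          w                                                 ≡⟨ count-size W W-size ⟩
          count W                                           ≡⟨ count-split span-t W ⟩
          count (λ x → span-t x ∧ W x) + count (fresh t)    ≡⟨ cong (_+ count (fresh t)) (count-cong span⊆W) ⟩
          count span-t + count (fresh t)                    ≡⟨ cong (_+ count (fresh t))
                                                                 (sym (count-size span-t (span-size (vecs t) (proj₁ (good⇒ t gt))))) ⟩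
          r ^ k + count (fresh t) ∎
          where open ≡-Reasoning
        count-fresh : count (fresh t) ≡ w ∸ r ^ k
        count-fresh = trans (sym (ℕP.m+n∸m≡n (r ^ k) _)) (cong (_∸ r ^ k) (sym partition))

      good-size : ∀ k → Fin (prod k (λ i → w ∸ r ^ i)) ↔ ΣT (good {k})
      good-size zero    = mk↔ₛ′ (λ _ → [] , tt) (λ _ → zero) (λ { ([] , tt) → refl }) (λ { zero → refl })
      good-size (suc k) = ↔-trans (Σ-uniform (good-size k) (λ (t , gt) → fresh-size t gt)) extend
        where
        extend : Σ (ΣT (good {k})) (λ (t , _) → ΣT (fresh t)) ↔ ΣT (good {suc k})
        extend = mk↔ₛ′ (λ ((t , gt) , (x , fx)) → (x ∷ t) , T-∧-join fx gt)
                       (λ { ((x ∷ t) , g) → (t , proj₂ (T-∧-split {fresh t x} g)) , (x , proj₁ (T-∧-split {fresh t x} g)) })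
                       (λ { ((x ∷ t) , g) → ΣT-≡ refl })
                       (λ ((t , gt) , (x , fx)) → cong₂ (λ a b → (t , a) , (x , b)) (BoolP.T-irrelevant _ _) (BoolP.T-irrelevant _ _))

-- Fat subspaces.  FL and EL are the linear algebra over F = GF(q) and over
-- E = GF(q^g) itself; the fat k-subspaces turn out to be exactly the F-spans of
-- the E-independent k-tuples.
module FatSubspaces {q g : ℕ} (F : FieldOn q) (E : FieldOn (q ^ g)) (ι : Fin q → Fin (q ^ g))
                    (ι-emb : IsEmbedding F E ι) (s k : ℕ) where
  open Setting {q} {g} F E ι s
  open LinearAlgebra {q} {g} F E ι s

  id-emb : IsEmbedding E E (λ x → x)
  id-emb = record { ι-+ = λ _ _ → refl ; ι-* = λ _ _ → refl ; ι-1 = refl ; ι-inj = λ _ _ e → e }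

  module FL = OverSubfield F ι ι-emb
  module EL = OverSubfield E (λ x → x) id-emb

  F⇒E-span : ∀ {m} {u : Fin m → V} {v : V} → FL.InSpan u v → EL.InSpan u v
  F⇒E-span (c , v≗) = ι ∘ c , v≗

  E⇒F-indep : ∀ {m} {u : Fin m → V} → EL.Indep u → FL.Indep u
  E⇒F-indep indep c c≗0 i = IsEmbedding.ι-inj ι-emb (c i) _ (trans (indep (ι ∘ c) c≗0 i) (sym FL.σ-0))

  ESpan⊆ : ∀ {m} {P : V → Set} {u : Fin m → V} → (∀ v → P v → FL.InSpan u v) → ∀ v → ESpan P v → EL.InSpan u v
  ESpan⊆ P⊆ v (_ , c , x , x∈P , v≗) =
    EL.span-trans (λ i → F⇒E-span (P⊆ (x i) (x∈P i))) (c , v≗)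

  subspace-comb : ∀ {P : V → Set} → IsFSubspace P → ∀ {m} (c : Fin m → Fin q) (u : Fin m → V) →
                  (∀ i → P (u i)) → P (FL.comb c u)
  subspace-comb (P0 , _ , _)          {zero}  c u u∈P = P0
  subspace-comb sub@(_ , P+ , P•) {suc m} c u u∈P =
    P+ _ _ (P• (c zero) (u zero) (u∈P zero)) (subspace-comb sub (c ∘ suc) (u ∘ suc) (u∈P ∘ suc))

  ∈V-cong : ∀ {S : SubsetV} {v w : V} → v ≗ w → v ∈V S → w ∈V S
  ∈V-cong {S} v≗w = subst (_∈ S) (funToFin-cong v≗w)

  ∈V⇒∈ : ∀ {S : SubsetV} {x} → vec x ∈V S → x ∈ S
  ∈V⇒∈ {S} {x} = subst (_∈ S) (code-vec x)

  ∈⇒∈V : ∀ {S : SubsetV} {x} → x ∈ S → vec x ∈V S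
  ∈⇒∈V {S} {x} = subst (_∈ S) (sym (code-vec x))

  spanSubset : Tuple k → SubsetV
  spanSubset t = tabulate (FL.spanᵇ (vecs t))

  ∈span⁻ : ∀ t {x} → x ∈ spanSubset t → FL.InSpan (vecs t) (vec x)
  ∈span⁻ t x∈ = toWitness (∈-tabulate⁻ (FL.spanᵇ (vecs t)) x∈)

  ∈span⁺ : ∀ t {x} → FL.InSpan (vecs t) (vec x) → x ∈ spanSubset t
  ∈span⁺ t x∈ = ∈-tabulate⁺ (FL.spanᵇ (vecs t)) (fromWitness x∈)

  ∈Vspan⁻ : ∀ t {v} → v ∈V spanSubset t → FL.InSpan (vecs t) v
  ∈Vspan⁻ t {v} v∈ = FL.InSpan-cong (λ _ _ → refl) (vec-code v) (∈span⁻ t v∈)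

  ∈Vspan⁺ : ∀ t {v} → FL.InSpan (vecs t) v → v ∈V spanSubset t
  ∈Vspan⁺ t {v} v∈ = ∈span⁺ t (FL.InSpan-cong (λ _ _ → refl) (λ j → sym (vec-code v j)) v∈)

  span-fat : ∀ t → EL.Indep (vecs t) → IsFat k (spanSubset t)
  span-fat t indep = subspace , (vecs t , member , E⇒F-indep indep , λ v → ∈Vspan⁻ t) ,
                     (vecs t , E-member , indep , ESpan⊆ (λ v → ∈Vspan⁻ t))
    where
    member : ∀ i → vecs t i ∈V spanSubset t
    member i = ∈Vspan⁺ t (FL.span-member (vecs t) i)
    E-member : ∀ i → ESpan (_∈V spanSubset t) (vecs t i)
    E-member i = 1 , (λ _ → E.1#) , (λ _ → vecs t i) , (λ _ → member i) ,
                 (λ j → sym (trans (E.+-identityʳ _) (E.*-identityˡ _)))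
    subspace : IsFSubspace (_∈V spanSubset t)
    subspace = ∈Vspan⁺ t (FL.span-0 (vecs t)) ,
               (λ _ _ x∈ y∈ → ∈Vspan⁺ t (FL.span-+ (∈Vspan⁻ t x∈) (∈Vspan⁻ t y∈))) ,
               (λ a _ v∈ → ∈Vspan⁺ t (FL.span-• a (∈Vspan⁻ t v∈)))

  -- Conversely a fat k-subspace S is the F-span of the F-basis u it comes with, and
  -- u is E-independent: the E-basis w of ⟨S⟩_E lies in the E-span of u, so the
  -- exchange lemma over E applies.
  fat⇒span : ∀ S → IsFat k S → ∃ λ t → EL.Indep (vecs t) × spanSubset t ≡ S
  fat⇒span S (subspace , (u , u∈S , _ , u-spans) , (w , w∈ , w-indep , _)) =
    t , t-indep , ⊆-antisym span⊆S S⊆span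
    where
    t : Tuple k
    t = tabulate (funToFin ∘ u)
    t≗u : ∀ i → vecs t i ≗ u i
    t≗u i j = trans (cong (λ x → vec x j) (VecP.lookup∘tabulate (funToFin ∘ u) i)) (vec-code (u i) j)
    t-spans : ∀ v → v ∈V S → FL.InSpan (vecs t) v
    t-spans v v∈ = FL.InSpan-cong (λ i j → sym (t≗u i j)) (λ _ → refl) (u-spans v v∈)
    t-indep : EL.Indep (vecs t)
    t-indep = proj₂ (EL.exchange w-indep (λ i → ESpan⊆ t-spans (w i) (w∈ i)))
    span⊆S : spanSubset t ⊆ S
    span⊆S {x} x∈ with ∈span⁻ t x∈
    ... | c , x≗ = ∈V⇒∈ {S} (∈V-cong {S} (λ j → sym (trans (x≗ j) (linComb-congʳ (ι ∘ c) t≗u j)))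
                                       (subspace-comb subspace c u u∈S))
    S⊆span : S ⊆ spanSubset t
    S⊆span x∈ = ∈span⁺ t (t-spans _ (∈⇒∈V {S} x∈))

  span⊆span : ∀ {t t′ : Tuple k} → (∀ i → FL.InSpan (vecs t′) (vecs t i)) → spanSubset t ⊆ spanSubset t′
  span⊆span {t} {t′} t⊆t′ x∈ = ∈span⁺ t′ (FL.span-trans t⊆t′ (∈span⁻ t x∈))

  same-span⇒ : ∀ {t₀ t : Tuple k} → EL.Indep (vecs t) → spanSubset t ≡ spanSubset t₀ →
               FL.Indep (vecs t) × (∀ i → FL.InSpan (vecs t₀) (vecs t i))
  same-span⇒ {t₀} {t} indep span≡ =
    E⇒F-indep indep , λ i → ∈span⁻ t₀ (subst (lookup t i ∈_) span≡ (∈span⁺ t (FL.span-member (vecs t) i)))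

  ⇒same-span : ∀ {t₀ t : Tuple k} → EL.Indep (vecs t₀) → FL.Indep (vecs t) → (∀ i → FL.InSpan (vecs t₀) (vecs t i)) →
               EL.Indep (vecs t) × spanSubset t ≡ spanSubset t₀
  ⇒same-span {t₀} {t} indep₀ indep t⊆t₀ = E-indep , ⊆-antisym (span⊆span {t} {t₀} t⊆t₀) (span⊆span {t₀} {t} t₀⊆t)
    where
    t₀⊆t : ∀ i → FL.InSpan (vecs t) (vecs t₀ i)
    t₀⊆t = proj₁ (FL.exchange {w = vecs t} {u = vecs t₀} indep t⊆t₀)
    E-indep : EL.Indep (vecs t)
    E-indep = proj₂ (EL.exchange {w = vecs t₀} {u = vecs t} indep₀ (F⇒E-span ∘ t₀⊆t))

  -- E-independent k-tuples, all of V being closed under spans.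
  module AllTuples = EL.IndependentTuples (λ _ → true) (mk↔ₛ′ (λ x → x , tt) proj₁ (λ _ → refl) (λ _ → refl))
                                          (λ _ _ _ _ → tt)

  E-indepᵇ : Tuple k → Bool
  E-indepᵇ = AllTuples.good

  SpannedBy : SubsetV → Tuple k → Bool
  SpannedBy S t = E-indepᵇ t ∧ isYes (VecP.≡-dec BoolP._≟_ (spanSubset t) S)

  spanned? : ∀ S → Dec (∃ λ t → T (SpannedBy S t))
  spanned? S = any?-enum (vecEnum k ↔-refl) (λ t → T? (SpannedBy S t))

  fatᵇ : SubsetV → Bool
  fatᵇ S = isYes (spanned? S)

  SpannedBy⇒ : ∀ {S t} → T (SpannedBy S t) → EL.Indep (vecs t) × spanSubset t ≡ S
  SpannedBy⇒ {S} {t} p with T-∧-split {E-indepᵇ t} p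
  ... | indep , span≡ = proj₁ (AllTuples.good⇒ t indep) , toWitness span≡

  ⇒SpannedBy : ∀ {S t} → EL.Indep (vecs t) → spanSubset t ≡ S → T (SpannedBy S t)
  ⇒SpannedBy {t = t} indep span≡ = T-∧-join (AllTuples.⇒good t indep (λ _ → tt)) (fromWitness span≡)

  fatᵇ-correct : ΣT fatᵇ ↔ 𝓕 k
  fatᵇ-correct = mk↔ₛ′ to from (λ _ → refl) (λ _ → ΣT-≡ refl)
    where
    fatᵇ⇒fat : ∀ {S} → T (fatᵇ S) → IsFat k S
    fatᵇ⇒fat {S} p with toWitness {a? = spanned? S} p
    ... | t , spans with SpannedBy⇒ {S} {t} spans
    ...   | indep , refl = span-fat t indep
    fat⇒fatᵇ : ∀ {S} → IsFat k S → T (fatᵇ S)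
    fat⇒fatᵇ {S} fat = witness (fat⇒span S fat)
      where
      witness : (∃ λ t → EL.Indep (vecs t) × spanSubset t ≡ S) → T (fatᵇ S)
      witness (t , indep , span≡) = fromWitness {a? = spanned? S} (t , ⇒SpannedBy {S} {t} indep span≡)
    to : ΣT fatᵇ → 𝓕 k
    to (S , p) = S , [ fatᵇ⇒fat p ]
    from : 𝓕 k → ΣT fatᵇ
    from (S , [ fat ]) = S , recompute (T? (fatᵇ S)) (fat⇒fatᵇ fat)

  -- The tuples spanning the F-span of an E-independent t₀ are the F-independent
  -- k-tuples with entries in that span, so there are ∏_{i<k} (q^k - q^i) of them.
  span-fibre-size : ∀ t₀ → EL.Indep (vecs t₀) → Fin (prod k (λ i → q ^ k ∸ q ^ i)) ↔ ΣT (SpannedBy (spanSubset t₀))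
  span-fibre-size t₀ indep₀ = ↔-trans (InSpan₀.good-size k) (ΣT-cong λ t → T-ext (to t) (from t))
    where
    W-closed : ∀ {m} (t : Tuple m) → (∀ i → T (FL.spanᵇ (vecs t₀) (lookup t i))) →
               ∀ x → T (FL.spanᵇ (vecs t) x) → T (FL.spanᵇ (vecs t₀) x)
    W-closed t t⊆ x x∈ = fromWitness (FL.span-trans (toWitness ∘ t⊆) (toWitness x∈))
    module InSpan₀ = FL.IndependentTuples (FL.spanᵇ (vecs t₀)) (FL.span-size (vecs t₀) (E⇒F-indep indep₀)) W-closed
    to : ∀ t → T (InSpan₀.good t) → T (SpannedBy (spanSubset t₀) t)
    to t g = let (indep , t⊆) = InSpan₀.good⇒ t g
                 (E-indep , span≡) = ⇒same-span {t₀} {t} indep₀ indep (toWitness ∘ t⊆)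
             in ⇒SpannedBy {spanSubset t₀} {t} E-indep span≡
    from : ∀ t → T (SpannedBy (spanSubset t₀) t) → T (InSpan₀.good t)
    from t p = let (E-indep , span≡) = SpannedBy⇒ {spanSubset t₀} {t} p
                   (indep , t⊆) = same-span⇒ {t₀} {t} E-indep span≡
               in InSpan₀.⇒good t indep (fromWitness ∘ t⊆)

  -- Every fat S is such a span, so the same count holds for all fibres over 𝓕_k.
  fibre-size : ∀ S → T (fatᵇ S) → Fin (prod k (λ i → q ^ k ∸ q ^ i)) ↔ ΣT (SpannedBy S)
  fibre-size S p = let (t₀ , spans₀) = toWitness {a? = spanned? S} p
                       (indep₀ , span≡) = SpannedBy⇒ {S} {t₀} spans₀
                   in subst (λ S′ → Fin (prod k (λ i → q ^ k ∸ q ^ i)) ↔ ΣT (SpannedBy S′)) span≡ (span-fibre-size t₀ indep₀)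

  sort-by-span : ΣT E-indepᵇ ↔ Σ (ΣT fatᵇ) (λ (S , _) → ΣT (SpannedBy S))
  sort-by-span = mk↔ₛ′ to from to∘from (λ _ → ΣT-≡ refl)
    where
    spans-own : ∀ t → T (E-indepᵇ t) → T (SpannedBy (spanSubset t) t)
    spans-own t indep = T-∧-join indep (fromWitness refl)
    to : ΣT E-indepᵇ → Σ (ΣT fatᵇ) (λ (S , _) → ΣT (SpannedBy S))
    to (t , indep) = (spanSubset t , fromWitness {a? = spanned? (spanSubset t)} (t , spans-own t indep)) , (t , spans-own t indep)
    from : Σ (ΣT fatᵇ) (λ (S , _) → ΣT (SpannedBy S)) → ΣT E-indepᵇ
    from (_ , (t , p)) = t , proj₁ (T-∧-split {E-indepᵇ t} p)
    reassemble : ∀ t S (fat : T (fatᵇ S)) (p : T (SpannedBy S t)) → spanSubset t ≡ S →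
                 to (from ((S , fat) , (t , p))) ≡ ((S , fat) , (t , p))
    reassemble t _ fat p refl = cong₂ (λ a b → (spanSubset t , a) , (t , b)) (BoolP.T-irrelevant _ _) (BoolP.T-irrelevant _ _)
    to∘from : ∀ y → to (from y) ≡ y
    to∘from ((S , fat) , (t , p)) = reassemble t S fat p (proj₂ (SpannedBy⇒ {S} {t} p))

  count-fat : ∃[ N ] ((Fin N ↔ 𝓕 k) × N * prod k (λ i → q ^ k ∸ q ^ i) ≡ prod k (λ i → Q ^ s ∸ Q ^ i))
  count-fat = N , ↔-trans enum fatᵇ-correct ,
              ↔-size (Σ-uniform enum (λ (S , fat) → fibre-size S fat)) (↔-trans (AllTuples.good-size k) sort-by-span)
    where
    subsets : Fin (2 ^ M) ↔ SubsetV
    subsets = vecEnum M FinP.2↔Bool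
    N : ℕ
    N = count (fatᵇ ∘ Inverse.to subsets)
    enum : Fin N ↔ ΣT fatᵇ
    enum = ↔-trans (countEnum _) (ΣT-transport subsets fatᵇ)

pow-diff : ∀ b n i → i ≤ n → b ^ n ∸ b ^ i ≡ b ^ i * (b ^ (n ∸ i) ∸ 1)
pow-diff b n i i≤n = begin
  b ^ n ∸ b ^ i                    ≡⟨ cong (λ e → b ^ e ∸ b ^ i) (sym (ℕP.m+[n∸m]≡n i≤n)) ⟩
  b ^ (i + (n ∸ i)) ∸ b ^ i        ≡⟨ cong (_∸ b ^ i) (ℕP.^-distribˡ-+-* b i (n ∸ i)) ⟩
  b ^ i * b ^ (n ∸ i) ∸ b ^ i      ≡⟨ cong (b ^ i * b ^ (n ∸ i) ∸_) (ℕP.*-identityʳ (b ^ i)) ⟨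
  b ^ i * b ^ (n ∸ i) ∸ b ^ i * 1  ≡⟨ ℕP.*-distribˡ-∸ (b ^ i) (b ^ (n ∸ i)) 1 ⟨
  b ^ i * (b ^ (n ∸ i) ∸ 1) ∎
  where open ≡-Reasoning

prod-cong : ∀ k {f h : ℕ → ℕ} → (∀ i → f i ≡ h i) → prod k f ≡ prod k h
prod-cong zero    e = refl
prod-cong (suc k) e = cong₂ _*_ (prod-cong k e) (e k)

-- ∏_{i<k} (b^n - b^i) = b^(k choose 2) ∏_{i<k} (b^(n-i) - 1) for k ≤ n, pulling b^i
-- out of the i-th factor and using (k+1 choose 2) = (k choose 2) + k.
prod-pow-diff : ∀ b n k → k ≤ n → prod k (λ i → b ^ n ∸ b ^ i) ≡ b ^ (k C 2) * prod k (λ i → b ^ (n ∸ i) ∸ 1)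
prod-pow-diff b n zero    _   = refl
prod-pow-diff b n (suc k) k<n = begin
  prod k (λ i → b ^ n ∸ b ^ i) * (b ^ n ∸ b ^ k)
    ≡⟨ cong₂ _*_ (prod-pow-diff b n k (ℕP.<⇒≤ k<n)) (pow-diff b n k (ℕP.<⇒≤ k<n)) ⟩
  (b ^ (k C 2) * R) * (b ^ k * Y)  ≡⟨ *-Comm.interchange (b ^ (k C 2)) R (b ^ k) Y ⟩
  (b ^ (k C 2) * b ^ k) * (R * Y)  ≡⟨ cong (_* (R * Y)) (ℕP.^-distribˡ-+-* b (k C 2) k) ⟨
  b ^ (k C 2 + k) * (R * Y)        ≡⟨ cong (λ e → b ^ e * (R * Y)) (sym suc-C2) ⟩
  b ^ (suc k C 2) * (R * Y) ∎
  where
  open ≡-Reasoning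
  R Y : ℕ
  R = prod k (λ i → b ^ (n ∸ i) ∸ 1)
  Y = b ^ (n ∸ k) ∸ 1
  suc-C2 : suc k C 2 ≡ k C 2 + k
  suc-C2 = trans (sym (nCk+nC[k+1]≡[n+1]C[k+1] k 1)) (trans (cong (_+ k C 2) (nC1≡n k)) (ℕP.+-comm k _))

-- The double-counting identity N ∏ (q^k - q^i) = ∏ (Q^s - Q^i), Q = q^g, in the
-- form of the theorem: both products contain the factor q^(k choose 2), which cancels.
cancel-common-factor : ∀ q g s k N → .{{NonZero q}} → 1 ≤ g → k ≤ s →
  N * prod k (λ i → q ^ k ∸ q ^ i) ≡ prod k (λ i → (q ^ g) ^ s ∸ (q ^ g) ^ i) →
  N * prod k (λ i → q ^ (k ∸ i) ∸ 1) ≡ q ^ ((g ∸ 1) * (k C 2)) * prod k (λ i → q ^ (g * (s ∸ i)) ∸ 1)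
cancel-common-factor q g s k N g≥1 k≤s counted = ℕP.*-cancelˡ-≡ _ _ (q ^ a) {{ℕP.m^n≢0 q a}} (begin
  q ^ a * (N * PF)                                    ≡⟨ *-Comm.x∙yz≈y∙xz (q ^ a) N PF ⟩
  N * (q ^ a * PF)                                    ≡⟨ cong (N *_) (prod-pow-diff q k k ℕP.≤-refl) ⟨
  N * prod k (λ i → q ^ k ∸ q ^ i)                    ≡⟨ counted ⟩
  prod k (λ i → (q ^ g) ^ s ∸ (q ^ g) ^ i)            ≡⟨ prod-pow-diff (q ^ g) s k k≤s ⟩
  (q ^ g) ^ a * prod k (λ i → (q ^ g) ^ (s ∸ i) ∸ 1)  ≡⟨ cong₂ _*_ Qᵃ (prod-cong k (λ i → cong (_∸ 1) (ℕP.^-*-assoc q g (s ∸ i)))) ⟩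
  (q ^ a * q ^ ((g ∸ 1) * a)) * PE                    ≡⟨ ℕP.*-assoc (q ^ a) _ PE ⟩
  q ^ a * (q ^ ((g ∸ 1) * a) * PE) ∎)
  where
  open ≡-Reasoning
  a PF PE : ℕ
  a  = k C 2
  PF = prod k (λ i → q ^ (k ∸ i) ∸ 1)
  PE = prod k (λ i → q ^ (g * (s ∸ i)) ∸ 1)
  Qᵃ : (q ^ g) ^ a ≡ q ^ a * q ^ ((g ∸ 1) * a)
  Qᵃ = trans (ℕP.^-*-assoc q g a)
             (trans (cong (λ e → q ^ (e * a)) (sym (ℕP.m+[n∸m]≡n g≥1))) (ℕP.^-distribˡ-+-* q a _))

PrimePower⇒NonZero : ∀ {q} → IsPrimePower q → NonZero q
PrimePower⇒NonZero (p , e , p-prime , _ , refl) = ℕP.m^n≢0 p e {{prime⇒nonZero p-prime}}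

-- Theorem: #𝓕_k ∏_{i<k} (q^(k-i) - 1) = q^((g-1)(k choose 2)) ∏_{i<k} (q^(g(s-i)) - 1).
mainTheorem7 : (q g s k : ℕ) → IsPrimePower q → 1 ≤ g → 1 ≤ s → 1 ≤ k → k ≤ s →
               (F : FieldOn q) (E : FieldOn (q ^ g)) (ι : Fin q → Fin (q ^ g)) →
               IsEmbedding F E ι →
               ∃[ N ] ((Fin N ↔ Setting.𝓕 {q} {g} F E ι s k) ×
                 (N * prod k (λ i → q ^ (k ∸ i) ∸ 1)
                   ≡ q ^ ((g ∸ 1) * (k C 2)) * prod k (λ i → q ^ (g * (s ∸ i)) ∸ 1)))
mainTheorem7 q g s k q-pp g≥1 _ _ k≤s F E ι ι-emb =
  let (N , enumeration , counted) = FatSubspaces.count-fat F E ι ι-emb s k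
  in N , enumeration , cancel-common-factor q g s k N {{PrimePower⇒NonZero q-pp}} g≥1 k≤s counted
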